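{- Let $n\ge 2$, let $H_n^4$ be any graph in $\mathscr{H}_n^4$, and let $I$ be a nonempty subset of $V(H_n^4)$. If the induced subgraph $H_n^4[I]$ has average degree $l$, then $|I|\ge 2^{l-1}$.
   Context: The family $\mathscr{H}_n^4$ ($n\ge 2$): $\mathscr{H}_2^4=\{K_4\}$; for $n\ge 3$, a graph is in $\mathscr{H}_n^4$ iff (up to isomorphism) it is obtained from two vertex-disjoint graphs $G_0,G_1\in\mathscr{H}_{n-1}^4$ (not necessarily isomorphic) by adding an arbitrary perfect matching between them. The average degree of a graph $G$ is $2|E(G)|/|V(G)|$. -}

module Defs where

open import Data.Nat using (ℕ; zero; suc; _+_; _*_)
open import Data.Bool using (Bool; true; false; not; _∧_; if_then_else_)
open import Data.Fin using (Fin; splitAt)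
open import Data.Fin.Properties using (_≟_)
open import Data.Fin.Permutation using (Permutation′; _⟨$⟩ʳ_)
open import Data.Fin.Subset using (Subset)
open import Data.Vec using (lookup)
open import Data.Sum using (inj₁; inj₂)
open import Relation.Nullary.Decidable using (⌊_⌋)

Adj : ℕ → Set
Adj v = Fin v → Fin v → Bool

-- Codes for members of the family ℋ_n^4 (up to isomorphism).
-- HCode n v : a graph of ℋ_n^4 with vertex set Fin v (v = 2^n).
--  * k4 : ℋ_2^4 = {K_4}
--  * join G₀ G₁ π : disjoint union of G₀ (vertices Fin v, first half of
--    Fin (v + v)) and G₁ (second half), plus the perfect matching
--    {x , π x} given by the bijection π : V(G₀) → V(G₁).
data HCode : ℕ → ℕ → Set where
  k4   : HCode 2 4
  join : ∀ {n v} → HCode n v → HCode n v → Permutation′ v → HCode (suc n) (v + v)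

adj : ∀ {n v} → HCode n v → Adj v
adj k4 i j = not ⌊ i ≟ j ⌋
adj (join {v = v} G₀ G₁ π) i j with splitAt v i | splitAt v j
... | inj₁ a | inj₁ b = adj G₀ a b
... | inj₂ a | inj₂ b = adj G₁ a b
... | inj₁ a | inj₂ b = ⌊ (π ⟨$⟩ʳ a) ≟ b ⌋
... | inj₂ a | inj₁ b = ⌊ (π ⟨$⟩ʳ b) ≟ a ⌋

sumFin : ∀ {k} → (Fin k → ℕ) → ℕ
sumFin {zero}  f = 0
sumFin {suc k} f = f Fin.zero + sumFin (λ i → f (Fin.suc i))

bit : Bool → ℕ
bit true  = 1
bit false = 0

-- Degree sum of the induced subgraph G[I] = Σ_{x ∈ I} deg_{G[I]}(x)
-- = number of ordered pairs (x , y) with x , y ∈ I and x ~ y  (= 2 |E(G[I])|).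
degSum : ∀ {v} → Adj v → Subset v → ℕ
degSum {v} A I = sumFin (λ x → sumFin (λ y →
  bit (lookup I x ∧ lookup I y ∧ A x y)))

{-# OPTIONS --safe #-}
module Submission where

-- Induct along the construction. For H = join G₀ G₁ π, split I into its halves I₀, I₁ with
-- a = |I₀| and b = |I₁|. The adjacent ordered pairs in I are those in I₀, those in I₁, and each
-- matching edge between I₀ and I₁ twice; there are at most min(a, b) such edges since π is a
-- bijection. So the bound 2^D ≤ (2m)^m (D the degree sum of H[I], m = |I|) passes from the halves
-- to I because (2a)^a (2b)^b 4^min(a,b) ≤ (2(a+b))^(a+b). For a ≤ b, group the left side as
-- (2a · 2b · 4)^a (2b)^(b−a) and use AM–GM, 16ab ≤ (2(a+b))², and 2b ≤ 2(a+b). The base case K₄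
-- is a check of its 16 vertex subsets.

open import Defs
open import Algebra.Bundles using (CommutativeMonoid)
open import Data.Bool using (Bool; true; false; _∧_)
open import Data.Bool.Properties using (∧-commutativeMonoid)
open import Algebra.Properties.CommutativeSemigroup
  (CommutativeMonoid.commutativeSemigroup ∧-commutativeMonoid) using (x∙yz≈y∙xz)
open import Data.Fin using (Fin; zero; suc; _↑ˡ_; _↑ʳ_)
open import Data.Fin.Permutation using (Permutation′; _⟨$⟩ʳ_; _⟨$⟩ˡ_; inverseˡ; inverseʳ)
  renaming (flip to _⁻¹)
open import Data.Fin.Properties using (_≟_; splitAt-↑ˡ; splitAt-↑ʳ)
open import Data.Fin.Subset using (Subset; Nonempty; ∣_∣)
open import Data.Nat using (ℕ; zero; suc; _+_; _*_; _^_; _≤_; z≤n)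
open import Data.Nat.Properties
  using (+-assoc; +-comm; *-assoc; *-comm; ≤-refl; ≤-reflexive; ≤-trans; ≤-total; +-mono-≤; *-mono-≤;
         *-monoˡ-≤; *-monoʳ-≤; m≤m+n; m≤n+m; m≤n⇒∃[o]m+o≡n; ^-distribˡ-+-*; ^-*-assoc;
         ^-monoˡ-≤; ^-monoʳ-≤; ≤ᵇ⇒≤; +-0-commutativeMonoid; module ≤-Reasoning)
open import Algebra.Properties.CommutativeMonoid.Sum +-0-commutativeMonoid
  using (sum; sum-syntax; sum-cong-≗; sum-replicate-zero; ∑-comm)
open import Data.Nat.Tactic.RingSolver using (solve-∀)
open import Data.Product using (_,_)
open import Data.Sum using ([_,_]′)
open import Data.Vec using (_∷_; []; lookup; _++_)
import Data.Vec as Vec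
open import Data.Vec.Properties using (lookup-++ˡ; lookup-++ʳ)
open import Function using (_∘_; flip)
open import Function.Bundles using (_⇔_; mk⇔)
open import Relation.Binary.PropositionalEquality
open import Relation.Nullary.Decidable using (⌊_⌋; does; isYes≗does; ⌊⌋-map′; does-⇔)

sumFin≗sum : ∀ {n} (f : Fin n → ℕ) → sumFin f ≡ sum f
sumFin≗sum {zero} f = refl
sumFin≗sum {suc n} f = cong (f zero +_) (sumFin≗sum (f ∘ suc))

sum-mono-≤ : ∀ {n} {f g : Fin n → ℕ} → (∀ i → f i ≤ g i) → sum f ≤ sum g
sum-mono-≤ {zero} f≤g = z≤n
sum-mono-≤ {suc n} f≤g = +-mono-≤ (f≤g zero) (sum-mono-≤ (f≤g ∘ suc))

sum-split : ∀ m n (f : Fin (m + n) → ℕ) → sum f ≡ sum (f ∘ (_↑ˡ n)) + sum (f ∘ (m ↑ʳ_))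
sum-split zero n f = refl
sum-split (suc m) n f = trans (cong (f zero +_) (sum-split m n (f ∘ suc))) (sym (+-assoc (f zero) _ _))

∑-indicator : ∀ {n} (k : Fin n) → ∑[ y < n ] bit ⌊ k ≟ y ⌋ ≡ 1
∑-indicator {suc n} zero = cong suc (sum-replicate-zero n)
∑-indicator {suc n} (suc k) =
  trans (sum-cong-≗ (λ y → cong bit (⌊⌋-map′ _ _ (k ≟ y)))) (∑-indicator k)

∣p∣≡∑ : ∀ {n} (P : Subset n) → ∣ P ∣ ≡ ∑[ x < n ] bit (lookup P x)
∣p∣≡∑ [] = refl
∣p∣≡∑ (true ∷ P) = cong suc (∣p∣≡∑ P)
∣p∣≡∑ (false ∷ P) = ∣p∣≡∑ P

∣p++q∣≡∣p∣+∣q∣ : ∀ {m n} (P : Subset m) (Q : Subset n) → ∣ P ++ Q ∣ ≡ ∣ P ∣ + ∣ Q ∣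
∣p++q∣≡∣p∣+∣q∣ [] Q = refl
∣p++q∣≡∣p∣+∣q∣ (true ∷ P) Q = cong suc (∣p++q∣≡∣p∣+∣q∣ P Q)
∣p++q∣≡∣p∣+∣q∣ (false ∷ P) Q = ∣p++q∣≡∣p∣+∣q∣ P Q

pairCount : ∀ {m n} → Subset m → Subset n → (Fin m → Fin n → Bool) → ℕ
pairCount {m} {n} P Q r = ∑[ x < m ] ∑[ y < n ] bit (lookup P x ∧ lookup Q y ∧ r x y)

degSum≡pairCount : ∀ {v} (A : Adj v) (I : Subset v) → degSum A I ≡ pairCount I I A
degSum≡pairCount {v} A I =
  trans (sumFin≗sum (sumFin ∘ entry)) (sum-cong-≗ (sumFin≗sum ∘ entry))
  where
  entry : Fin v → Fin v → ℕ
  entry x y = bit (lookup I x ∧ lookup I y ∧ A x y)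

pairCount-cong : ∀ {m n} (P : Subset m) (Q : Subset n) {r s : Fin m → Fin n → Bool} →
  (∀ x y → r x y ≡ s x y) → pairCount P Q r ≡ pairCount P Q s
pairCount-cong P Q r≗s =
  sum-cong-≗ (λ x → sum-cong-≗ (λ y → cong (λ b → bit (lookup P x ∧ lookup Q y ∧ b)) (r≗s x y)))

pairCount-transpose : ∀ {m n} (P : Subset m) (Q : Subset n) (r : Fin m → Fin n → Bool) →
  pairCount P Q r ≡ pairCount Q P (flip r)
pairCount-transpose P Q r = trans (∑-comm (λ x y → bit (lookup P x ∧ lookup Q y ∧ r x y)))
  (sum-cong-≗ (λ y → sum-cong-≗ (λ x → cong bit (x∙yz≈y∙xz (lookup P x) (lookup Q y) (r x y)))))

pairCount-++ˡ : ∀ {m₀ m₁ n} (P₀ : Subset m₀) (P₁ : Subset m₁) (Q : Subset n)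
  (r : Fin (m₀ + m₁) → Fin n → Bool) →
  pairCount (P₀ ++ P₁) Q r ≡ pairCount P₀ Q (r ∘ (_↑ˡ m₁)) + pairCount P₁ Q (r ∘ (m₀ ↑ʳ_))
pairCount-++ˡ {m₀} {m₁} P₀ P₁ Q r = trans (sum-split m₀ m₁ _) (cong₂ _+_
  (sum-cong-≗ (λ x → sum-cong-≗ (λ y →
    cong (λ b → bit (b ∧ lookup Q y ∧ r (x ↑ˡ m₁) y)) (lookup-++ˡ P₀ P₁ x))))
  (sum-cong-≗ (λ x → sum-cong-≗ (λ y →
    cong (λ b → bit (b ∧ lookup Q y ∧ r (m₀ ↑ʳ x) y)) (lookup-++ʳ P₀ P₁ x)))))

pairCount-++ʳ : ∀ {m n₀ n₁} (P : Subset m) (Q₀ : Subset n₀) (Q₁ : Subset n₁)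
  (r : Fin m → Fin (n₀ + n₁) → Bool) →
  pairCount P (Q₀ ++ Q₁) r ≡
  pairCount P Q₀ (λ x y → r x (y ↑ˡ n₁)) + pairCount P Q₁ (λ x y → r x (n₀ ↑ʳ y))
pairCount-++ʳ {n₀ = n₀} {n₁} P Q₀ Q₁ r = begin
  pairCount P (Q₀ ++ Q₁) r
    ≡⟨ pairCount-transpose P (Q₀ ++ Q₁) r ⟩
  pairCount (Q₀ ++ Q₁) P (flip r)
    ≡⟨ pairCount-++ˡ Q₀ Q₁ P (flip r) ⟩
  pairCount Q₀ P (flip r ∘ (_↑ˡ n₁)) + pairCount Q₁ P (flip r ∘ (n₀ ↑ʳ_))
    ≡⟨ sym (cong₂ _+_ (pairCount-transpose P Q₀ _) (pairCount-transpose P Q₁ _)) ⟩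
  pairCount P Q₀ (λ x y → r x (y ↑ˡ n₁)) + pairCount P Q₁ (λ x y → r x (n₀ ↑ʳ y))
    ∎
  where open ≡-Reasoning

bit-∧-≤ʳ : ∀ a b → bit (a ∧ b) ≤ bit b
bit-∧-≤ʳ true b = ≤-refl
bit-∧-≤ʳ false b = z≤n

pairCount≤∣P∣ : ∀ {m n} (P : Subset m) (Q : Subset n) {r : Fin m → Fin n → Bool} →
  (∀ x → ∑[ y < n ] bit (r x y) ≤ 1) → pairCount P Q r ≤ ∣ P ∣
pairCount≤∣P∣ {m} {n} P Q {r} rows≤1 = begin
  pairCount P Q r              ≤⟨ sum-mono-≤ row≤bit ⟩
  ∑[ x < m ] bit (lookup P x)  ≡⟨ ∣p∣≡∑ P ⟨
  ∣ P ∣                        ∎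
  where
  open ≤-Reasoning
  row≤bit : ∀ x → ∑[ y < n ] bit (lookup P x ∧ lookup Q y ∧ r x y) ≤ bit (lookup P x)
  row≤bit x with lookup P x
  ... | true  = ≤-trans (sum-mono-≤ (λ y → bit-∧-≤ʳ (lookup Q y) (r x y))) (rows≤1 x)
  ... | false = ≤-reflexive (sum-replicate-zero n)

Matching : ∀ {v} → Permutation′ v → Fin v → Fin v → Bool
Matching π x y = ⌊ π ⟨$⟩ʳ x ≟ y ⌋

Matching-⁻¹ : ∀ {v} (π : Permutation′ v) x y → Matching π x y ≡ Matching (π ⁻¹) y x
Matching-⁻¹ π x y = begin
  ⌊ π ⟨$⟩ʳ x ≟ y ⌋      ≡⟨ isYes≗does (π ⟨$⟩ʳ x ≟ y) ⟩
  does (π ⟨$⟩ʳ x ≟ y)   ≡⟨ does-⇔ πx≡y⇔π⁻¹y≡x (π ⟨$⟩ʳ x ≟ y) (π ⟨$⟩ˡ y ≟ x) ⟩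
  does (π ⟨$⟩ˡ y ≟ x)   ≡⟨ isYes≗does (π ⟨$⟩ˡ y ≟ x) ⟨
  ⌊ π ⟨$⟩ˡ y ≟ x ⌋      ∎
  where
  open ≡-Reasoning
  πx≡y⇔π⁻¹y≡x : π ⟨$⟩ʳ x ≡ y ⇔ π ⟨$⟩ˡ y ≡ x
  πx≡y⇔π⁻¹y≡x = mk⇔
    (λ πx≡y → trans (cong (π ⟨$⟩ˡ_) (sym πx≡y)) (inverseˡ π))
    (λ π⁻¹y≡x → trans (cong (π ⟨$⟩ʳ_) (sym π⁻¹y≡x)) (inverseʳ π))

pairCount-Matching≤ˡ : ∀ {v} (P Q : Subset v) (π : Permutation′ v) →
  pairCount P Q (Matching π) ≤ ∣ P ∣
pairCount-Matching≤ˡ P Q π = pairCount≤∣P∣ P Q (λ x → ≤-reflexive (∑-indicator (π ⟨$⟩ʳ x)))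

pairCount-Matching≤ʳ : ∀ {v} (P Q : Subset v) (π : Permutation′ v) →
  pairCount P Q (Matching π) ≤ ∣ Q ∣
pairCount-Matching≤ʳ P Q π = begin
  pairCount P Q (Matching π)         ≡⟨ pairCount-transpose P Q (Matching π) ⟩
  pairCount Q P (flip (Matching π))  ≡⟨ pairCount-cong Q P (λ y x → Matching-⁻¹ π x y) ⟩
  pairCount Q P (Matching (π ⁻¹))    ≤⟨ pairCount-Matching≤ˡ Q P (π ⁻¹) ⟩
  ∣ Q ∣                              ∎
  where open ≤-Reasoning

module _ {n v} (G₀ G₁ : HCode n v) (π : Permutation′ v) where

  private
    H : Adj (v + v)
    H = adj (join G₀ G₁ π)

  adj-join-↑ˡ-↑ˡ : ∀ i j → H (i ↑ˡ v) (j ↑ˡ v) ≡ adj G₀ i j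
  adj-join-↑ˡ-↑ˡ i j rewrite splitAt-↑ˡ v i v | splitAt-↑ˡ v j v = refl

  adj-join-↑ˡ-↑ʳ : ∀ i j → H (i ↑ˡ v) (v ↑ʳ j) ≡ Matching π i j
  adj-join-↑ˡ-↑ʳ i j rewrite splitAt-↑ˡ v i v | splitAt-↑ʳ v v j = refl

  adj-join-↑ʳ-↑ˡ : ∀ i j → H (v ↑ʳ i) (j ↑ˡ v) ≡ Matching π j i
  adj-join-↑ʳ-↑ˡ i j rewrite splitAt-↑ʳ v v i | splitAt-↑ˡ v j v = refl

  adj-join-↑ʳ-↑ʳ : ∀ i j → H (v ↑ʳ i) (v ↑ʳ j) ≡ adj G₁ i j
  adj-join-↑ʳ-↑ʳ i j rewrite splitAt-↑ʳ v v i | splitAt-↑ʳ v v j = refl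

  pairCount-join : ∀ (I₀ I₁ : Subset v) →
    pairCount (I₀ ++ I₁) (I₀ ++ I₁) H ≡
    pairCount I₀ I₀ (adj G₀) + pairCount I₁ I₁ (adj G₁) + 2 * pairCount I₀ I₁ (Matching π)
  pairCount-join I₀ I₁ = begin
    pairCount (I₀ ++ I₁) (I₀ ++ I₁) H
      ≡⟨ pairCount-++ˡ I₀ I₁ (I₀ ++ I₁) H ⟩
    pairCount I₀ (I₀ ++ I₁) _ + pairCount I₁ (I₀ ++ I₁) _
      ≡⟨ cong₂ _+_ (pairCount-++ʳ I₀ I₀ I₁ _) (pairCount-++ʳ I₁ I₀ I₁ _) ⟩
    (pairCount I₀ I₀ _ + pairCount I₀ I₁ _) + (pairCount I₁ I₀ _ + pairCount I₁ I₁ _)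
      ≡⟨ cong₂ _+_ (cong₂ _+_ (pairCount-cong I₀ I₀ adj-join-↑ˡ-↑ˡ) (pairCount-cong I₀ I₁ adj-join-↑ˡ-↑ʳ))
                   (cong₂ _+_ (pairCount-cong I₁ I₀ adj-join-↑ʳ-↑ˡ) (pairCount-cong I₁ I₁ adj-join-↑ʳ-↑ʳ)) ⟩
    (D₀ + M) + (pairCount I₁ I₀ (flip (Matching π)) + D₁)
      ≡⟨ cong (λ M′ → (D₀ + M) + (M′ + D₁)) (pairCount-transpose I₀ I₁ (Matching π)) ⟨
    (D₀ + M) + (M + D₁)
      ≡⟨ regroup D₀ M D₁ ⟩
    D₀ + D₁ + 2 * M
      ∎
    where
    open ≡-Reasoning
    D₀ D₁ M : ℕ
    D₀ = pairCount I₀ I₀ (adj G₀)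
    D₁ = pairCount I₁ I₁ (adj G₁)
    M  = pairCount I₀ I₁ (Matching π)
    regroup : ∀ a m b → (a + m) + (m + b) ≡ a + b + 2 * m
    regroup = solve-∀

^-distribʳ-* : ∀ m n k → (m * n) ^ k ≡ m ^ k * n ^ k
^-distribʳ-* m n zero = refl
^-distribʳ-* m n (suc k) =
  trans (cong (m * n *_) (^-distribʳ-* m n k)) (interchange m n (m ^ k) (n ^ k))
  where
  interchange : ∀ a b c d → a * b * (c * d) ≡ a * c * (b * d)
  interchange = solve-∀

four-mul≤square-+ : ∀ a b → 4 * (a * b) ≤ (a + b) * (a + b)
four-mul≤square-+ a b = [ ordered , flipped ]′ (≤-total a b)
  where
  ordered : ∀ {a b} → a ≤ b → 4 * (a * b) ≤ (a + b) * (a + b)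
  ordered {a} a≤b with c , refl ← m≤n⇒∃[o]m+o≡n a≤b =
    ≤-trans (m≤m+n _ (c * c)) (≤-reflexive (square a c))
    where
    square : ∀ a c → 4 * (a * (a + c)) + c * c ≡ (a + (a + c)) * (a + (a + c))
    square = solve-∀
  flipped : b ≤ a → 4 * (a * b) ≤ (a + b) * (a + b)
  flipped b≤a = subst₂ _≤_ (cong (4 *_) (*-comm b a)) (cong (λ s → s * s) (+-comm b a)) (ordered b≤a)

^-merge-ordered : ∀ {a b} → a ≤ b → (2 * a) ^ a * (2 * b) ^ b * 4 ^ a ≤ (2 * (a + b)) ^ (a + b)
^-merge-ordered {a} a≤b with c , refl ← m≤n⇒∃[o]m+o≡n a≤b = begin
  (2 * a) ^ a * (2 * b) ^ (a + c) * 4 ^ a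
    ≡⟨ cong (λ t → (2 * a) ^ a * t * 4 ^ a) (^-distribˡ-+-* (2 * b) a c) ⟩
  (2 * a) ^ a * ((2 * b) ^ a * (2 * b) ^ c) * 4 ^ a
    ≡⟨ regroup ((2 * a) ^ a) ((2 * b) ^ a) ((2 * b) ^ c) (4 ^ a) ⟩
  (2 * a) ^ a * (2 * b) ^ a * 4 ^ a * (2 * b) ^ c
    ≡⟨ cong (_* (2 * b) ^ c) product-pow ⟨
  (2 * a * (2 * b) * 4) ^ a * (2 * b) ^ c
    ≤⟨ *-mono-≤ (^-monoˡ-≤ a product≤s²) (^-monoˡ-≤ c (*-monoʳ-≤ 2 (m≤n+m b a))) ⟩
  (s * s) ^ a * s ^ c
    ≡⟨ cong (_* s ^ c) (^-distribʳ-* s s a) ⟩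
  s ^ a * s ^ a * s ^ c
    ≡⟨ *-assoc (s ^ a) (s ^ a) (s ^ c) ⟩
  s ^ a * (s ^ a * s ^ c)
    ≡⟨ cong (s ^ a *_) (^-distribˡ-+-* s a c) ⟨
  s ^ a * s ^ b
    ≡⟨ ^-distribˡ-+-* s a b ⟨
  s ^ (a + b)
    ∎
  where
  open ≤-Reasoning
  b s : ℕ
  b = a + c
  s = 2 * (a + b)
  product-pow : (2 * a * (2 * b) * 4) ^ a ≡ (2 * a) ^ a * (2 * b) ^ a * 4 ^ a
  product-pow = trans (^-distribʳ-* (2 * a * (2 * b)) 4 a) (cong (_* 4 ^ a) (^-distribʳ-* (2 * a) (2 * b) a))
  regroup : ∀ x y z w → x * (y * z) * w ≡ x * y * w * z
  regroup = solve-∀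
  product≤s² : 2 * a * (2 * b) * 4 ≤ s * s
  product≤s² = begin
    2 * a * (2 * b) * 4          ≡⟨ lhs a b ⟩
    4 * (4 * (a * b))            ≤⟨ *-monoʳ-≤ 4 (four-mul≤square-+ a b) ⟩
    4 * ((a + b) * (a + b))      ≡⟨ rhs a b ⟩
    s * s                        ∎
    where
    lhs : ∀ a b → 2 * a * (2 * b) * 4 ≡ 4 * (4 * (a * b))
    lhs = solve-∀
    rhs : ∀ a b → 4 * ((a + b) * (a + b)) ≡ 2 * (a + b) * (2 * (a + b))
    rhs = solve-∀

^-merge : ∀ {a b c} → c ≤ a → c ≤ b → (2 * a) ^ a * (2 * b) ^ b * 4 ^ c ≤ (2 * (a + b)) ^ (a + b)
^-merge {a} {b} {c} c≤a c≤b = [ ordered , flipped ]′ (≤-total a b)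
  where
  open ≤-Reasoning
  ordered : a ≤ b → (2 * a) ^ a * (2 * b) ^ b * 4 ^ c ≤ (2 * (a + b)) ^ (a + b)
  ordered a≤b = ≤-trans (*-monoʳ-≤ ((2 * a) ^ a * (2 * b) ^ b) (^-monoʳ-≤ 4 c≤a)) (^-merge-ordered a≤b)
  flipped : b ≤ a → (2 * a) ^ a * (2 * b) ^ b * 4 ^ c ≤ (2 * (a + b)) ^ (a + b)
  flipped b≤a = begin
    (2 * a) ^ a * (2 * b) ^ b * 4 ^ c  ≡⟨ cong (_* 4 ^ c) (*-comm ((2 * a) ^ a) ((2 * b) ^ b)) ⟩
    (2 * b) ^ b * (2 * a) ^ a * 4 ^ c  ≤⟨ *-monoʳ-≤ ((2 * b) ^ b * (2 * a) ^ a) (^-monoʳ-≤ 4 c≤b) ⟩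
    (2 * b) ^ b * (2 * a) ^ a * 4 ^ b  ≤⟨ ^-merge-ordered b≤a ⟩
    (2 * (b + a)) ^ (b + a)            ≡⟨ cong (λ t → (2 * t) ^ t) (+-comm b a) ⟩
    (2 * (a + b)) ^ (a + b)            ∎

2^-bound-merge : ∀ {a b c D₀ D₁} → 2 ^ D₀ ≤ (2 * a) ^ a → 2 ^ D₁ ≤ (2 * b) ^ b → c ≤ a → c ≤ b →
  2 ^ (D₀ + D₁ + 2 * c) ≤ (2 * (a + b)) ^ (a + b)
2^-bound-merge {a} {b} {c} {D₀} {D₁} bound₀ bound₁ c≤a c≤b = begin
  2 ^ (D₀ + D₁ + 2 * c)              ≡⟨ ^-distribˡ-+-* 2 (D₀ + D₁) (2 * c) ⟩
  2 ^ (D₀ + D₁) * 2 ^ (2 * c)        ≡⟨ cong₂ _*_ (^-distribˡ-+-* 2 D₀ D₁) (sym (^-*-assoc 2 2 c)) ⟩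
  2 ^ D₀ * 2 ^ D₁ * 4 ^ c            ≤⟨ *-monoˡ-≤ (4 ^ c) (*-mono-≤ bound₀ bound₁) ⟩
  (2 * a) ^ a * (2 * b) ^ b * 4 ^ c  ≤⟨ ^-merge c≤a c≤b ⟩
  (2 * (a + b)) ^ (a + b)            ∎
  where open ≤-Reasoning

degree-bound-K₄ : ∀ (I : Subset 4) → 2 ^ pairCount I I (adj k4) ≤ (2 * ∣ I ∣) ^ ∣ I ∣
degree-bound-K₄ (true  ∷ true  ∷ true  ∷ true  ∷ []) = ≤ᵇ⇒≤ _ _ _
degree-bound-K₄ (true  ∷ true  ∷ true  ∷ false ∷ []) = ≤ᵇ⇒≤ _ _ _
degree-bound-K₄ (true  ∷ true  ∷ false ∷ true  ∷ []) = ≤ᵇ⇒≤ _ _ _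
degree-bound-K₄ (true  ∷ true  ∷ false ∷ false ∷ []) = ≤ᵇ⇒≤ _ _ _
degree-bound-K₄ (true  ∷ false ∷ true  ∷ true  ∷ []) = ≤ᵇ⇒≤ _ _ _
degree-bound-K₄ (true  ∷ false ∷ true  ∷ false ∷ []) = ≤ᵇ⇒≤ _ _ _
degree-bound-K₄ (true  ∷ false ∷ false ∷ true  ∷ []) = ≤ᵇ⇒≤ _ _ _
degree-bound-K₄ (true  ∷ false ∷ false ∷ false ∷ []) = ≤ᵇ⇒≤ _ _ _
degree-bound-K₄ (false ∷ true  ∷ true  ∷ true  ∷ []) = ≤ᵇ⇒≤ _ _ _
degree-bound-K₄ (false ∷ true  ∷ true  ∷ false ∷ []) = ≤ᵇ⇒≤ _ _ _
degree-bound-K₄ (false ∷ true  ∷ false ∷ true  ∷ []) = ≤ᵇ⇒≤ _ _ _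
degree-bound-K₄ (false ∷ true  ∷ false ∷ false ∷ []) = ≤ᵇ⇒≤ _ _ _
degree-bound-K₄ (false ∷ false ∷ true  ∷ true  ∷ []) = ≤ᵇ⇒≤ _ _ _
degree-bound-K₄ (false ∷ false ∷ true  ∷ false ∷ []) = ≤ᵇ⇒≤ _ _ _
degree-bound-K₄ (false ∷ false ∷ false ∷ true  ∷ []) = ≤ᵇ⇒≤ _ _ _
degree-bound-K₄ (false ∷ false ∷ false ∷ false ∷ []) = ≤ᵇ⇒≤ _ _ _

degree-bound : ∀ {n v} (H : HCode n v) (I : Subset v) →
  2 ^ pairCount I I (adj H) ≤ (2 * ∣ I ∣) ^ ∣ I ∣
degree-bound k4 I = degree-bound-K₄ I
degree-bound (join {v = v} G₀ G₁ π) I with I₀ , I₁ , refl ← Vec.splitAt v I = begin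
  2 ^ pairCount (I₀ ++ I₁) (I₀ ++ I₁) (adj (join G₀ G₁ π))
    ≡⟨ cong (2 ^_) (pairCount-join G₀ G₁ π I₀ I₁) ⟩
  2 ^ (pairCount I₀ I₀ (adj G₀) + pairCount I₁ I₁ (adj G₁) + 2 * pairCount I₀ I₁ (Matching π))
    ≤⟨ 2^-bound-merge {D₀ = pairCount I₀ I₀ (adj G₀)} {D₁ = pairCount I₁ I₁ (adj G₁)}
                      (degree-bound G₀ I₀) (degree-bound G₁ I₁)
                      (pairCount-Matching≤ˡ I₀ I₁ π) (pairCount-Matching≤ʳ I₀ I₁ π) ⟩
  (2 * (∣ I₀ ∣ + ∣ I₁ ∣)) ^ (∣ I₀ ∣ + ∣ I₁ ∣)
    ≡⟨ cong (λ m → (2 * m) ^ m) (∣p++q∣≡∣p∣+∣q∣ I₀ I₁) ⟨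
  (2 * ∣ I₀ ++ I₁ ∣) ^ ∣ I₀ ++ I₁ ∣
    ∎
  where open ≤-Reasoning

-- The bound also holds for I = ∅, where both sides are 1.
lemma6p2 : ∀ {n v} (H : HCode n v) (I : Subset v) → Nonempty I →
    2 ^ degSum (adj H) I ≤ (2 * ∣ I ∣) ^ ∣ I ∣
lemma6p2 H I _ =
  subst (λ D → 2 ^ D ≤ (2 * ∣ I ∣) ^ ∣ I ∣) (sym (degSum≡pairCount (adj H) I)) (degree-bound H I)
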